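{- For all cut-free derivations $f, g$ of the same sequent $S \mid \Gamma \vdash C$ in the skew monoidal sequent calculus, if $f \circeq g$ then $\mathrm{sound}\, f \doteq \mathrm{sound}\, g$.
   Context: Fix a set $\mathrm{Var}$ of atoms. Formulae: atoms $X \in \mathrm{Var}$, $\mathsf{I}$, and $A \otimes B$ for formulae $A, B$. A context is a finite list of formulae; a stoup $S$ is either empty (written $-$) or a single formula. Categorical calculus: judgements $A \Rightarrow C$ derived by $\mathrm{id}_A : A \Rightarrow A$; $g \circ f : A \Rightarrow C$ from $f : A \Rightarrow B$, $g : B \Rightarrow C$; $f \otimes g : A \otimes B \Rightarrow C \otimes D$ from $f : A \Rightarrow C$, $g : B \Rightarrow D$; axioms $\lambda_A : \mathsf{I} \otimes A \Rightarrow A$, $\rho_A : A \Rightarrow A \otimes \mathsf{I}$, $\alpha_{A,B,C} : (A \otimes B) \otimes C \Rightarrow A \otimes (B \otimes C)$. The relation $\doteq$ is the least congruence (w.r.t. $\circ$ and $\otimes$) on derivations containing: $f \circ \mathrm{id} \doteq f \doteq \mathrm{id} \circ f$; $h \circ (g \circ f) \doteq (h \circ g) \circ f$; $\mathrm{id}_A \otimes \mathrm{id}_B \doteq \mathrm{id}_{A \otimes B}$; $(h \circ f) \otimes (k \circ g) \doteq (h \otimes k) \circ (f \otimes g)$; $\lambda_B \circ (\mathrm{id}_{\mathsf I} \otimes f) \doteq f \circ \lambda_A$; $(f \otimes \mathrm{id}_{\mathsf I}) \circ \rho_A \doteq \rho_B \circ f$; $(f \otimes (g \otimes h)) \circ \alpha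 \doteq \alpha \circ ((f \otimes g) \otimes h)$; $\lambda_{\mathsf I} \circ \rho_{\mathsf I} \doteq \mathrm{id}_{\mathsf I}$; $(\mathrm{id}_A \otimes \lambda_B) \circ \alpha_{A,\mathsf I,B} \circ (\rho_A \otimes \mathrm{id}_B) \doteq \mathrm{id}_{A \otimes B}$; $\lambda_{A \otimes B} \circ \alpha_{\mathsf I,A,B} \doteq \lambda_A \otimes \mathrm{id}_B$; $\alpha_{A,B,\mathsf I} \circ \rho_{A \otimes B} \doteq \mathrm{id}_A \otimes \rho_B$; $\alpha_{A,B,C \otimes D} \circ \alpha_{A \otimes B,C,D} \doteq (\mathrm{id}_A \otimes \alpha_{B,C,D}) \circ \alpha_{A,B \otimes C,D} \circ (\alpha_{A,B,C} \otimes \mathrm{id}_D)$. Cut-free sequent calculus: sequents $S \mid \Gamma \vdash C$ derived by (ax) $A \mid\ \vdash A$; (pass) from $A \mid \Gamma \vdash C$ infer $- \mid A, \Gamma \vdash C$; ($\mathsf I$L) from $- \mid \Gamma \vdash C$ infer $\mathsf I \mid \Gamma \vdash C$; ($\mathsf I$R) $- \mid\ \vdash \mathsf I$; ($\otimes$L) from $A \mid B, \Gamma \vdash C$ infer $A \otimes B \mid \Gamma \vdash C$; ($\otimes$R) from $S \mid \Gamma \vdash A$ and $- \mid \Delta \vdash B$ infer $S \mid \Gamma, \Delta \vdash A \otimes B$. The relation $\circeq$ is the least congruence on cut-free derivations (w.r.t. all rules) containing: $\mathrm{ax}_{\mathsf I} \circeq \mathsf{I}\mathrm{L}(\mathsf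 I\mathrm R)$; $\mathrm{ax}_{A \otimes B} \circeq \otimes\mathrm L(\otimes\mathrm R(\mathrm{ax}_A, \mathrm{pass}(\mathrm{ax}_B)))$; $\otimes\mathrm R(\mathrm{pass}\, f, g) \circeq \mathrm{pass}(\otimes\mathrm R(f, g))$; $\otimes\mathrm R(\mathsf I\mathrm L\, f, g) \circeq \mathsf I\mathrm L(\otimes\mathrm R(f, g))$; $\otimes\mathrm R(\otimes\mathrm L\, f, g) \circeq \otimes\mathrm L(\otimes\mathrm R(f, g))$ (for all $f, g$ of appropriate types). Interpretation: $\llbracket - \rrbracket = \mathsf I$, $\llbracket A \rrbracket = A$; $\llbracket S \mid A_1,\dots,A_n \rrbracket = (\cdots(\llbracket S \rrbracket \otimes A_1)\cdots) \otimes A_n$. For $f : A \Rightarrow B$: $\llbracket f \mid () \rrbracket = f$, $\llbracket f \mid C, \Gamma \rrbracket = \llbracket f \otimes \mathrm{id}_C \mid \Gamma \rrbracket : \llbracket A \mid C,\Gamma\rrbracket \Rightarrow \llbracket B\mid C,\Gamma\rrbracket$. Define $\psi_{A,B,()} = \mathrm{id}_{A \otimes B}$, $\psi_{A,B,(C,\Gamma)} = \psi_{A,B \otimes C,\Gamma} \circ \llbracket \alpha_{A,B,C} \mid \Gamma \rrbracket : \llbracket A \otimes B \mid C,\Gamma\rrbracket \Rightarrow A \otimes \llbracket B \mid C,\Gamma\rrbracket$; $\varphi'_{A,(),\Delta} = \psi_{A,\mathsf I,\Delta} \circ \llbracket \rho_A \mid \Delta \rrbracket$, $\varphi'_{A,(C,\Gamma),\Delta}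 = \varphi'_{A \otimes C,\Gamma,\Delta}$, and $\varphi_{S,\Gamma,\Delta} = \varphi'_{\llbracket S \rrbracket,\Gamma,\Delta} : \llbracket S \mid \Gamma,\Delta \rrbracket \Rightarrow \llbracket S \mid \Gamma \rrbracket \otimes \llbracket - \mid \Delta \rrbracket$. The translation $\mathrm{sound}$ sends a cut-free derivation of $S \mid \Gamma \vdash C$ to a categorical derivation $\llbracket S \mid \Gamma \rrbracket \Rightarrow C$: $\mathrm{sound}(\mathrm{ax}_C) = \mathrm{id}_C$; $\mathrm{sound}(\mathrm{pass}\, f) = \mathrm{sound}\, f \circ \llbracket \lambda_A \mid \Gamma' \rrbracket$ for $f : A \mid \Gamma' \vdash C$; $\mathrm{sound}(\mathsf I\mathrm L\, f) = \mathrm{sound}\, f$; $\mathrm{sound}(\otimes\mathrm L\, f) = \mathrm{sound}\, f$; $\mathrm{sound}(\mathsf I\mathrm R) = \mathrm{id}_{\mathsf I}$; $\mathrm{sound}(\otimes\mathrm R(f_1, f_2)) = (\mathrm{sound}\, f_1 \otimes \mathrm{sound}\, f_2) \circ \varphi_{S,\Gamma_1,\Gamma_2}$ for $f_1 : S \mid \Gamma_1 \vdash C_1$, $f_2 : - \mid \Gamma_2 \vdash C_2$. -}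

module Defs where

open import Data.List using (List; []; _∷_; _++_)
open import Data.Maybe using (Maybe; nothing; just)

module SkewMonoidal (Var : Set) where

  infixl 25 _⊗_
  data Fma : Set where
    ` : Var → Fma
    I : Fma
    _⊗_ : Fma → Fma → Fma

  -- Stoup: empty (nothing) or a single formula; contexts
  Stp : Set
  Stp = Maybe Fma

  Cxt : Set
  Cxt = List Fma

  infix 15 _⇒_
  infixl 20 _∘_
  data _⇒_ : Fma → Fma → Set where
    id : {A : Fma} → A ⇒ A
    _∘_ : {A B C : Fma} → B ⇒ C → A ⇒ B → A ⇒ C
    _⊗_ : {A B C D : Fma} → A ⇒ C → B ⇒ D → A ⊗ B ⇒ C ⊗ D
    l : {A : Fma} → I ⊗ A ⇒ A
    ρ : {A : Fma} → A ⇒ A ⊗ I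
    α : {A B C : Fma} → (A ⊗ B) ⊗ C ⇒ A ⊗ (B ⊗ C)

  infix 15 _≐_
  data _≐_ : {A B : Fma} → A ⇒ B → A ⇒ B → Set where
    refl : {A B : Fma} {f : A ⇒ B} → f ≐ f
    ~_ : {A B : Fma} {f g : A ⇒ B} → f ≐ g → g ≐ f
    _∙_ : {A B : Fma} {f g h : A ⇒ B} → f ≐ g → g ≐ h → f ≐ h
    _∘_ : {A B C : Fma} {f g : B ⇒ C} {h k : A ⇒ B} →
      f ≐ g → h ≐ k → f ∘ h ≐ g ∘ k
    _⊗_ : {A B C D : Fma} {f g : A ⇒ C} {h k : B ⇒ D} →
      f ≐ g → h ≐ k → f ⊗ h ≐ g ⊗ k
    lid : {A B : Fma} {f : A ⇒ B} → id ∘ f ≐ f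
    rid : {A B : Fma} {f : A ⇒ B} → f ≐ f ∘ id
    ass : {A B C D : Fma} {f : A ⇒ B} {g : B ⇒ C} {h : C ⇒ D} →
      h ∘ (g ∘ f) ≐ (h ∘ g) ∘ f
    f⊗id : {A B : Fma} → id {A} ⊗ id {B} ≐ id
    f⊗∘ : {A B C D E F : Fma} {f : A ⇒ C} {g : B ⇒ D} {h : C ⇒ E} {k : D ⇒ F} →
      (h ∘ f) ⊗ (k ∘ g) ≐ (h ⊗ k) ∘ (f ⊗ g)
    nl : {A B : Fma} {f : A ⇒ B} → l ∘ (id ⊗ f) ≐ f ∘ l
    nρ : {A B : Fma} {f : A ⇒ B} → (f ⊗ id) ∘ ρ ≐ ρ ∘ f
    nα : {A B C D E F : Fma} {f : A ⇒ D} {g : B ⇒ E} {h : C ⇒ F} →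
      (f ⊗ (g ⊗ h)) ∘ α ≐ α ∘ ((f ⊗ g) ⊗ h)
    lρ : l {I} ∘ ρ ≐ id
    lαρ : {A B : Fma} → (id {A} ⊗ l {B}) ∘ α ∘ (ρ ⊗ id) ≐ id
    lα : {A B : Fma} → l {A ⊗ B} ∘ α ≐ l ⊗ id
    αρ : {A B : Fma} → α {A} {B} {I} ∘ ρ ≐ id ⊗ ρ
    ααα : {A B C D : Fma} →
      α {A} {B} {C ⊗ D} ∘ α {A ⊗ B} {C} {D} ≐ (id ⊗ α) ∘ α ∘ (α ⊗ id)

  infix 15 _∣_⊢_
  data _∣_⊢_ : Stp → Cxt → Fma → Set where
    ax : {A : Fma} → just A ∣ [] ⊢ A
    pass : {Γ : Cxt} {A C : Fma} → just A ∣ Γ ⊢ C → nothing ∣ A ∷ Γ ⊢ C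
    Il : {Γ : Cxt} {C : Fma} → nothing ∣ Γ ⊢ C → just I ∣ Γ ⊢ C
    Ir : nothing ∣ [] ⊢ I
    ⊗l : {Γ : Cxt} {A B C : Fma} → just A ∣ B ∷ Γ ⊢ C → just (A ⊗ B) ∣ Γ ⊢ C
    ⊗r : {S : Stp} {Γ Δ : Cxt} {A B : Fma} →
      S ∣ Γ ⊢ A → nothing ∣ Δ ⊢ B → S ∣ Γ ++ Δ ⊢ A ⊗ B

  infix 15 _≗_
  data _≗_ : {S : Stp} {Γ : Cxt} {C : Fma} → S ∣ Γ ⊢ C → S ∣ Γ ⊢ C → Set where
    refl : {S : Stp} {Γ : Cxt} {C : Fma} {f : S ∣ Γ ⊢ C} → f ≗ f
    ~_ : {S : Stp} {Γ : Cxt} {C : Fma} {f g : S ∣ Γ ⊢ C} → f ≗ g → g ≗ f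
    _∙_ : {S : Stp} {Γ : Cxt} {C : Fma} {f g h : S ∣ Γ ⊢ C} →
      f ≗ g → g ≗ h → f ≗ h
    pass : {Γ : Cxt} {A C : Fma} {f g : just A ∣ Γ ⊢ C} →
      f ≗ g → pass f ≗ pass g
    Il : {Γ : Cxt} {C : Fma} {f g : nothing ∣ Γ ⊢ C} → f ≗ g → Il f ≗ Il g
    ⊗l : {Γ : Cxt} {A B C : Fma} {f g : just A ∣ B ∷ Γ ⊢ C} →
      f ≗ g → ⊗l f ≗ ⊗l g
    ⊗r : {S : Stp} {Γ Δ : Cxt} {A B : Fma} {f g : S ∣ Γ ⊢ A} {f' g' : nothing ∣ Δ ⊢ B} →
      f ≗ g → f' ≗ g' → ⊗r f f' ≗ ⊗r g g'
    axI : ax ≗ Il Ir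
    ax⊗ : {A B : Fma} → ax {A ⊗ B} ≗ ⊗l (⊗r ax (pass ax))
    ⊗rpass : {Γ Δ : Cxt} {A A' B : Fma} {f : just A' ∣ Γ ⊢ A} {g : nothing ∣ Δ ⊢ B} →
      ⊗r (pass f) g ≗ pass (⊗r f g)
    ⊗rIl : {Γ Δ : Cxt} {A B : Fma} {f : nothing ∣ Γ ⊢ A} {g : nothing ∣ Δ ⊢ B} →
      ⊗r (Il f) g ≗ Il (⊗r f g)
    ⊗r⊗l : {Γ Δ : Cxt} {A A' B B' : Fma} {f : just A' ∣ B' ∷ Γ ⊢ A} {g : nothing ∣ Δ ⊢ B} →
      ⊗r (⊗l f) g ≗ ⊗l (⊗r f g)

  t : Stp → Fma
  t nothing = I
  t (just A) = A

  ⟦_∣_⟧ : Fma → Cxt → Fma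
  ⟦ A ∣ [] ⟧ = A
  ⟦ A ∣ B ∷ Γ ⟧ = ⟦ A ⊗ B ∣ Γ ⟧

  ⟦_∣_⟧ₛ : Stp → Cxt → Fma
  ⟦ S ∣ Γ ⟧ₛ = ⟦ t S ∣ Γ ⟧

  ⟦_∣_⟧f : {A B : Fma} → A ⇒ B → (Γ : Cxt) → ⟦ A ∣ Γ ⟧ ⇒ ⟦ B ∣ Γ ⟧
  ⟦ f ∣ [] ⟧f = f
  ⟦ f ∣ C ∷ Γ ⟧f = ⟦ f ⊗ id {C} ∣ Γ ⟧f

  ψ : (A B : Fma) (Γ : Cxt) → ⟦ A ⊗ B ∣ Γ ⟧ ⇒ A ⊗ ⟦ B ∣ Γ ⟧
  ψ A B [] = id
  ψ A B (C ∷ Γ) = ψ A (B ⊗ C) Γ ∘ ⟦ α {A} {B} {C} ∣ Γ ⟧f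

  φ' : (A : Fma) (Γ Δ : Cxt) → ⟦ A ∣ Γ ++ Δ ⟧ ⇒ ⟦ A ∣ Γ ⟧ ⊗ ⟦ I ∣ Δ ⟧
  φ' A [] Δ = ψ A I Δ ∘ ⟦ ρ {A} ∣ Δ ⟧f
  φ' A (C ∷ Γ) Δ = φ' (A ⊗ C) Γ Δ

  φ : (S : Stp) (Γ Δ : Cxt) → ⟦ S ∣ Γ ++ Δ ⟧ₛ ⇒ ⟦ S ∣ Γ ⟧ₛ ⊗ ⟦ nothing ∣ Δ ⟧ₛ
  φ S Γ Δ = φ' (t S) Γ Δ

  sound : {S : Stp} {Γ : Cxt} {C : Fma} → S ∣ Γ ⊢ C → ⟦ S ∣ Γ ⟧ₛ ⇒ C
  sound ax = id
  sound (pass {Γ} {A} f) = sound f ∘ ⟦ l {A} ∣ Γ ⟧f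
  sound (Il f) = sound f
  sound (⊗l f) = sound f
  sound Ir = id
  sound (⊗r {S} {Γ} {Δ} f g) = (sound f ⊗ sound g) ∘ φ S Γ Δ

module Submission where

open import Data.List using ([]; _∷_; _++_)
open import Data.Maybe using (nothing; just)
open import Defs

-- Since sound ignores Il and ⊗l, the equations axI, ⊗rIl and
-- ⊗r⊗l hold on the nose, and ax⊗ is the triangle axiom lαρ. The only real
-- work is ⊗rpass, which moves l past φ; this is naturality of φ in the
-- formula in the stoup, inherited from the naturality of α and ρ because
-- ⟦_∣ Γ ⟧f is a functor.

module Soundness (Var : Set) where
  open SkewMonoidal Var

  paste-squares : {P Q Q' P' R R' : Fma}
    {x : P ⇒ Q} {a : Q ⇒ Q'} {b : P ⇒ P'} {y : P' ⇒ Q'}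
    {z : R ⇒ P} {c : R ⇒ R'} {w : R' ⇒ P'} →
    a ∘ x ≐ y ∘ b → b ∘ z ≐ w ∘ c → a ∘ (x ∘ z) ≐ (y ∘ w) ∘ c
  paste-squares sq₁ sq₂ = ass ∙ ((sq₁ ∘ refl) ∙ ((~ ass) ∙ ((refl ∘ sq₂) ∙ ass)))

  ⟦⟧f-cong : {A B : Fma} {f g : A ⇒ B} (Γ : Cxt) → f ≐ g → ⟦ f ∣ Γ ⟧f ≐ ⟦ g ∣ Γ ⟧f
  ⟦⟧f-cong [] p = p
  ⟦⟧f-cong (C ∷ Γ) p = ⟦⟧f-cong Γ (p ⊗ refl)

  ⟦⟧f-∘ : {A B D : Fma} {f : A ⇒ B} {g : B ⇒ D} (Γ : Cxt) →
    ⟦ g ∘ f ∣ Γ ⟧f ≐ ⟦ g ∣ Γ ⟧f ∘ ⟦ f ∣ Γ ⟧f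
  ⟦⟧f-∘ [] = refl
  ⟦⟧f-∘ (C ∷ Γ) = ⟦⟧f-cong Γ ((refl ⊗ (~ lid)) ∙ f⊗∘) ∙ ⟦⟧f-∘ Γ

  ⟦⟧f-square : {A B B' D : Fma} {f : A ⇒ B} {g : B ⇒ D} {h : A ⇒ B'} {k : B' ⇒ D}
    (Γ : Cxt) → g ∘ f ≐ k ∘ h → ⟦ g ∣ Γ ⟧f ∘ ⟦ f ∣ Γ ⟧f ≐ ⟦ k ∣ Γ ⟧f ∘ ⟦ h ∣ Γ ⟧f
  ⟦⟧f-square Γ p = (~ ⟦⟧f-∘ Γ) ∙ (⟦⟧f-cong Γ p ∙ ⟦⟧f-∘ Γ)

  ψ-natural : {A A' : Fma} (h : A ⇒ A') (B : Fma) (Γ : Cxt) →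
    (h ⊗ id) ∘ ψ A B Γ ≐ ψ A' B Γ ∘ ⟦ h ⊗ id ∣ Γ ⟧f
  ψ-natural h B [] = (~ rid) ∙ (~ lid)
  ψ-natural h B (C ∷ Γ) =
    paste-squares (ψ-natural h (B ⊗ C) Γ)
      (⟦⟧f-square Γ (((refl ⊗ (~ f⊗id)) ∘ refl) ∙ nα))

  φ'-natural : {A B : Fma} (h : A ⇒ B) (Γ Δ : Cxt) →
    (⟦ h ∣ Γ ⟧f ⊗ id) ∘ φ' A Γ Δ ≐ φ' B Γ Δ ∘ ⟦ h ∣ Γ ++ Δ ⟧f
  φ'-natural h [] Δ = paste-squares (ψ-natural h I Δ) (⟦⟧f-square Δ nρ)
  φ'-natural h (C ∷ Γ) Δ = φ'-natural (h ⊗ id) Γ Δ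

  sound-ax⊗ : {A B : Fma} → sound (ax {A ⊗ B}) ≐ sound (⊗l (⊗r ax (pass ax)))
  sound-ax⊗ = ~ (((refl ⊗ lid) ∘ (lid ∘ refl)) ∙ (ass ∙ lαρ))

  sound-⊗rpass : {Γ Δ : Cxt} {A A' B : Fma}
    (f : just A' ∣ Γ ⊢ A) (g : nothing ∣ Δ ⊢ B) →
    sound (⊗r (pass f) g) ≐ sound (pass (⊗r f g))
  sound-⊗rpass {Γ} {Δ} f g =
    (((refl ⊗ rid) ∙ f⊗∘) ∘ refl) ∙ ((~ ass) ∙ ((refl ∘ φ'-natural l Γ Δ) ∙ ass))

  sound-cong : {S : Stp} {Γ : Cxt} {C : Fma} {f g : S ∣ Γ ⊢ C} →
    f ≗ g → sound f ≐ sound g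
  sound-cong refl = refl
  sound-cong (~ p) = ~ sound-cong p
  sound-cong (p ∙ q) = sound-cong p ∙ sound-cong q
  sound-cong (pass p) = sound-cong p ∘ refl
  sound-cong (Il p) = sound-cong p
  sound-cong (⊗l p) = sound-cong p
  sound-cong (⊗r p q) = (sound-cong p ⊗ sound-cong q) ∘ refl
  sound-cong axI = refl
  sound-cong ax⊗ = sound-ax⊗
  sound-cong (⊗rpass {f = f} {g}) = sound-⊗rpass f g
  sound-cong ⊗rIl = refl
  sound-cong ⊗r⊗l = refl

lemma4p3 : (Var : Set) → let open SkewMonoidal Var in
    {S : Stp} {Γ : Cxt} {C : Fma} {f g : S ∣ Γ ⊢ C} →
    f ≗ g → sound f ≐ sound g
lemma4p3 Var = Soundness.sound-cong Var
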